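{- If $l = 1$, then the hypergraph $\mathcal{H}$ defined below is $C_3$-free; that is, there do not exist three distinct edges $e_1, e_2, e_3$ of $\mathcal{H}$ and three distinct vertices $v_1, v_2, v_3$ with $\{v_1, v_2\} \subseteq e_1$, $\{v_2, v_3\} \subseteq e_2$ and $\{v_3, v_1\} \subseteq e_3$.
   Context: Let $q$ be a power of an odd prime, and let $r \geq 2$ and $l \geq 1$ be integers. Let $\alpha_1, \dots, \alpha_r$ be distinct elements of $\mathbb{F}_q$, and let $m_1, \dots, m_l$ be distinct elements of $\mathbb{F}_q^* = \mathbb{F}_q \setminus\{0\}$ such that $m_s(\alpha_k - \alpha_i) \neq m_t(\alpha_k - \alpha_j)$ whenever $1 \leq s, t \leq l$ and $i, j, k$ are distinct integers in $\{1, \dots, r\}$. For $1 \leq i \leq r$ let $V_i = \mathbb{F}_q \times \mathbb{F}_q \times \{i\}$. For $x, y \in \mathbb{F}_q$, $a \in \mathbb{F}_q^*$ and $s \in \{1, \dots, l\}$, let \[ e(x,y,a,m_s) = \{ (x + \alpha_i m_s a,\; y + \alpha_i m_s a^2,\; i) : 1 \leq i \leq r \}. \] $\mathcal{H}$ is the $r$-uniform hypergraph with vertex set $V_1 \cup \dots \cup V_r$ and edge set $\{ e(x,y,a,m_s) : x,y \in \mathbb{F}_q,\ a \in \mathbb{F}_q^*,\ 1 \leq s \leq l\}$. -}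

module Defs where

open import Level using (0ℓ)
open import Data.Nat using (ℕ; _≤_; _^_)
open import Data.Nat.Primality using (Prime)
open import Data.Fin using (Fin)
open import Data.Product using (Σ; ∃; _×_; _,_)
open import Relation.Nullary using (¬_)
open import Relation.Binary.PropositionalEquality using (_≡_)
open import Algebra.Core using (Op₁; Op₂)
open import Algebra.Structures using (IsCommutativeRing)
open import Function.Bundles using (_↔_; _⇔_)

OddPrimePower : ℕ → Set
OddPrimePower q = Σ ℕ λ p → Σ ℕ λ k → Prime p × ¬ (p ≡ 2) × 1 ≤ k × q ≡ p ^ k

record FiniteField (q : ℕ) : Set₁ where
  infixl 7 _*_
  infixl 6 _+_ _-_
  infix 8 -_
  field
    Carrier : Set
    _+_ _*_ : Op₂ Carrier
    -_ : Op₁ Carrier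
    0# 1# : Carrier
    isCommutativeRing : IsCommutativeRing _≡_ _+_ _*_ -_ 0# 1#
    0≢1 : ¬ (0# ≡ 1#)
    inverse : ∀ x → ¬ (x ≡ 0#) → Σ Carrier λ y → x * y ≡ 1#
    enumeration : Fin q ↔ Carrier

  _-_ : Op₂ Carrier
  x - y = x + (- y)

module Hypergraph {q : ℕ} (F : FiniteField q) (r l : ℕ)
                  (α : Fin r → FiniteField.Carrier F)
                  (m : Fin l → FiniteField.Carrier F) where
  open FiniteField F

  -- V_1 ∪ … ∪ V_r, with V_i = F_q × F_q × {i}
  Vertex : Set
  Vertex = Carrier × Carrier × Fin r

  -- parameters (x, y, a, s) with a ∈ F_q^*, s ∈ {1,…,l} indexing an edge e(x,y,a,m_s)
  EdgeParam : Set
  EdgeParam = Carrier × Carrier × (Σ Carrier λ a → ¬ (a ≡ 0#)) × Fin l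

  vertexOf : EdgeParam → Fin r → Vertex
  vertexOf (x , y , (a , _) , s) i =
    (x + α i * m s * a , y + α i * m s * (a * a) , i)

  _∈E_ : Vertex → EdgeParam → Set
  v ∈E e = ∃ λ i → v ≡ vertexOf e i

  SameEdge : EdgeParam → EdgeParam → Set
  SameEdge e e' = ∀ v → (v ∈E e) ⇔ (v ∈E e')

  C3-free : Set
  C3-free =
    ¬ (Σ EdgeParam λ e₁ → Σ EdgeParam λ e₂ → Σ EdgeParam λ e₃ →
       Σ Vertex λ v₁ → Σ Vertex λ v₂ → Σ Vertex λ v₃ →
         ¬ SameEdge e₁ e₂ × ¬ SameEdge e₂ e₃ × ¬ SameEdge e₁ e₃ ×
         ¬ (v₁ ≡ v₂) × ¬ (v₂ ≡ v₃) × ¬ (v₁ ≡ v₃) ×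
         (v₁ ∈E e₁ × v₂ ∈E e₁) ×
         (v₂ ∈E e₂ × v₃ ∈E e₂) ×
         (v₃ ∈E e₃ × v₁ ∈E e₃))

module Submission where

-- Write B_i = α_i m for the single multiplier m = m_1.  The i-th
-- vertex of e(x,y,a,m) is (x + B_i a, y + B_i a², i), so two edges that share
-- a vertex share it in the same part i, and their coordinates satisfy
--   x + B_i a ≡ x' + B_i a'   and   y + B_i a² ≡ y' + B_i a'².
-- A Berge triangle e₁, e₂, e₃ meeting in parts j (e₁e₂), k (e₂e₃), i (e₃e₁)
-- gives three such equations per coordinate; summing them round the cycle
-- kills the translations x, y and leaves a linear and a quadratic relation
-- in a₁, a₂, a₃.  Eliminating B_k between them yields
--   (B_j - B_i)(a₁ - a₂)(a₁ - a₃) = 0,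
-- which is impossible: B_j ≠ B_i as i ≠ j, and a₁ ≠ a₂, a₁ ≠ a₃ because two
-- edges with one common vertex and the same a coincide.

open import Defs
open import Data.Nat using (ℕ; _≤_)
open import Data.Fin using (Fin; zero)
open import Data.Product using (∃; _,_; proj₁; proj₂)
open import Data.Empty using (⊥)
open import Function using (id; _∘_)
open import Function.Bundles using (mk⇔)
open import Relation.Nullary using (¬_)
open import Relation.Binary.PropositionalEquality
  using (_≡_; refl; sym; trans; cong; module ≡-Reasoning)
open import Level using (0ℓ)
open import Algebra.Bundles using (CommutativeRing)
open import Algebra.Structures using (IsCommutativeRing)
import Algebra.Properties.Group as GroupProperties
import Algebra.Solver.Ring.NaturalCoefficients.Default as SemiringSolver

module CycleRelations {c ℓ} (R : CommutativeRing c ℓ) where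
  open CommutativeRing R renaming (refl to ≈-refl; sym to ≈-sym)
  open GroupProperties +-group using (∙-cancelʳ)
  open SemiringSolver commutativeSemiring
  open import Relation.Binary.Reasoning.Setoid setoid

  cycle-balance : ∀ B₁ B₂ B₃ a₁ a₂ a₃ x₁ x₂ x₃ →
    x₁ + B₂ * a₁ ≈ x₂ + B₂ * a₂ →
    x₂ + B₃ * a₂ ≈ x₃ + B₃ * a₃ →
    x₃ + B₁ * a₃ ≈ x₁ + B₁ * a₁ →
    B₂ * a₁ + B₃ * a₂ + B₁ * a₃ ≈ B₂ * a₂ + B₃ * a₃ + B₁ * a₁
  cycle-balance B₁ B₂ B₃ a₁ a₂ a₃ x₁ x₂ x₃ e₁₂ e₂₃ e₃₁ =
    ∙-cancelʳ (x₁ + x₂ + x₃) _ _ (begin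
      B₂ * a₁ + B₃ * a₂ + B₁ * a₃ + (x₁ + x₂ + x₃)
        ≈⟨ solve 9 (λ B₁ B₂ B₃ a₁ a₂ a₃ x₁ x₂ x₃ →
             B₂ :* a₁ :+ B₃ :* a₂ :+ B₁ :* a₃ :+ (x₁ :+ x₂ :+ x₃) :=
             (x₁ :+ B₂ :* a₁) :+ (x₂ :+ B₃ :* a₂) :+ (x₃ :+ B₁ :* a₃))
             ≈-refl B₁ B₂ B₃ a₁ a₂ a₃ x₁ x₂ x₃ ⟩
      (x₁ + B₂ * a₁) + (x₂ + B₃ * a₂) + (x₃ + B₁ * a₃)
        ≈⟨ +-cong (+-cong e₁₂ e₂₃) e₃₁ ⟩
      (x₂ + B₂ * a₂) + (x₃ + B₃ * a₃) + (x₁ + B₁ * a₁)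
        ≈⟨ solve 9 (λ B₁ B₂ B₃ a₁ a₂ a₃ x₁ x₂ x₃ →
             (x₂ :+ B₂ :* a₂) :+ (x₃ :+ B₃ :* a₃) :+ (x₁ :+ B₁ :* a₁) :=
             B₂ :* a₂ :+ B₃ :* a₃ :+ B₁ :* a₁ :+ (x₁ :+ x₂ :+ x₃))
             ≈-refl B₁ B₂ B₃ a₁ a₂ a₃ x₁ x₂ x₃ ⟩
      B₂ * a₂ + B₃ * a₃ + B₁ * a₁ + (x₁ + x₂ + x₃) ∎)

  -- Subtracting (a₂ + a₃) times the linear balanced sum from the quadratic
  -- one eliminates B₃; in subtraction-free form the result states
  -- (B₂ - B₁)(a₁ - a₂)(a₁ - a₃) = 0.
  eliminate-third-direction : ∀ B₁ B₂ B₃ a₁ a₂ a₃ →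
    B₂ * a₁ + B₃ * a₂ + B₁ * a₃ ≈ B₂ * a₂ + B₃ * a₃ + B₁ * a₁ →
    B₂ * (a₁ * a₁) + B₃ * (a₂ * a₂) + B₁ * (a₃ * a₃) ≈
      B₂ * (a₂ * a₂) + B₃ * (a₃ * a₃) + B₁ * (a₁ * a₁) →
    B₂ * (a₁ * a₁ + a₂ * a₃) + B₁ * (a₁ * a₂ + a₁ * a₃) ≈
      B₁ * (a₁ * a₁ + a₂ * a₃) + B₂ * (a₁ * a₂ + a₁ * a₃)
  eliminate-third-direction B₁ B₂ B₃ a₁ a₂ a₃ linear quadratic =
    ∙-cancelʳ common _ _ (begin
      B₂ * (a₁ * a₁ + a₂ * a₃) + B₁ * (a₁ * a₂ + a₁ * a₃) + common
        ≈⟨ solve 6 (λ B₁ B₂ B₃ a₁ a₂ a₃ →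
             B₂ :* (a₁ :* a₁ :+ a₂ :* a₃) :+ B₁ :* (a₁ :* a₂ :+ a₁ :* a₃) :+
               (B₃ :* (a₂ :* a₂) :+ B₃ :* (a₃ :* a₃) :+ B₁ :* (a₃ :* a₃) :+
                B₂ :* (a₂ :* a₂) :+ B₃ :* (a₂ :* a₃)) :=
             B₂ :* (a₁ :* a₁) :+ B₃ :* (a₂ :* a₂) :+ B₁ :* (a₃ :* a₃) :+
               (a₂ :+ a₃) :* (B₂ :* a₂ :+ B₃ :* a₃ :+ B₁ :* a₁))
             ≈-refl B₁ B₂ B₃ a₁ a₂ a₃ ⟩
      B₂ * (a₁ * a₁) + B₃ * (a₂ * a₂) + B₁ * (a₃ * a₃) +
        (a₂ + a₃) * (B₂ * a₂ + B₃ * a₃ + B₁ * a₁)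
        ≈⟨ +-cong quadratic (*-congˡ (≈-sym linear)) ⟩
      B₂ * (a₂ * a₂) + B₃ * (a₃ * a₃) + B₁ * (a₁ * a₁) +
        (a₂ + a₃) * (B₂ * a₁ + B₃ * a₂ + B₁ * a₃)
        ≈⟨ solve 6 (λ B₁ B₂ B₃ a₁ a₂ a₃ →
             B₂ :* (a₂ :* a₂) :+ B₃ :* (a₃ :* a₃) :+ B₁ :* (a₁ :* a₁) :+
               (a₂ :+ a₃) :* (B₂ :* a₁ :+ B₃ :* a₂ :+ B₁ :* a₃) :=
             B₁ :* (a₁ :* a₁ :+ a₂ :* a₃) :+ B₂ :* (a₁ :* a₂ :+ a₁ :* a₃) :+
               (B₃ :* (a₂ :* a₂) :+ B₃ :* (a₃ :* a₃) :+ B₁ :* (a₃ :* a₃) :+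
                B₂ :* (a₂ :* a₂) :+ B₃ :* (a₂ :* a₃)))
             ≈-refl B₁ B₂ B₃ a₁ a₂ a₃ ⟩
      B₁ * (a₁ * a₁ + a₂ * a₃) + B₂ * (a₁ * a₂ + a₁ * a₃) + common ∎)
    where
    common : Carrier
    common = B₃ * (a₂ * a₂) + B₃ * (a₃ * a₃) + B₁ * (a₃ * a₃) +
             B₂ * (a₂ * a₂) + B₃ * (a₂ * a₃)

module FieldLemmas {q : ℕ} (F : FiniteField q) where
  open FiniteField F
  open IsCommutativeRing isCommutativeRing
    using (+-comm; +-identityʳ; *-comm; *-assoc; *-identityˡ)
  open ≡-Reasoning

  commutativeRing : CommutativeRing 0ℓ 0ℓ
  commutativeRing = record { isCommutativeRing = isCommutativeRing }

  open CommutativeRing commutativeRing using (+-group; commutativeSemiring)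
  open GroupProperties +-group using (//-rightDividesˡ)
  open GroupProperties +-group public using () renaming (∙-cancelʳ to +-cancelʳ)
  open SemiringSolver commutativeSemiring

  -- Every x is y shifted by some d; used to replace a difference x - y by a
  -- fresh variable so that the semiring solver applies.
  offset : ∀ x y → ∃ λ d → y + d ≡ x
  offset x y = x - y , trans (+-comm y (x - y)) (//-rightDividesˡ y x)

  nonzero-offset : ∀ {y d} → ¬ (y + d ≡ y) → ¬ (d ≡ 0#)
  nonzero-offset {y} moves d≡0 = moves (trans (cong (y +_) d≡0) (+-identityʳ y))

  *-cancelˡ-nonzero : ∀ {d u w} → ¬ (d ≡ 0#) → d * u ≡ d * w → u ≡ w
  *-cancelˡ-nonzero {d} {u} {w} d≢0 du≡dw with inverse d d≢0
  ... | d⁻¹ , dd⁻¹≡1 = begin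
    u                ≡⟨ sym (*-identityˡ u) ⟩
    1# * u           ≡⟨ cong (_* u) (sym dd⁻¹≡1) ⟩
    d * d⁻¹ * u      ≡⟨ regroup u ⟩
    d⁻¹ * (d * u)    ≡⟨ cong (d⁻¹ *_) du≡dw ⟩
    d⁻¹ * (d * w)    ≡⟨ sym (regroup w) ⟩
    d * d⁻¹ * w      ≡⟨ cong (_* w) dd⁻¹≡1 ⟩
    1# * w           ≡⟨ *-identityˡ w ⟩
    w                ∎
    where
    regroup : ∀ v → d * d⁻¹ * v ≡ d⁻¹ * (d * v)
    regroup v = trans (cong (_* v) (*-comm d d⁻¹)) (*-assoc d⁻¹ d v)

  *-cancelʳ-nonzero : ∀ {d u w} → ¬ (d ≡ 0#) → u * d ≡ w * d → u ≡ w
  *-cancelʳ-nonzero {d} {u} {w} d≢0 ud≡wd =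
    *-cancelˡ-nonzero d≢0 (trans (*-comm d u) (trans ud≡wd (*-comm w d)))

  -- b P + c R = c P + b R says (b - c)(P - R) = 0, so P = R when b ≠ c.
  cross-cancel : ∀ {b c P R} → b * P + c * R ≡ c * P + b * R → ¬ (b ≡ c) → P ≡ R
  cross-cancel {b} {c} {P} {R} balanced b≢c with offset b c
  ... | d , refl = *-cancelˡ-nonzero (nonzero-offset b≢c)
    (+-cancelʳ (c * P + c * R) _ _ (begin
      d * P + (c * P + c * R)
        ≡⟨ solve 4 (λ c d P R → d :* P :+ (c :* P :+ c :* R) :=
                                 (c :+ d) :* P :+ c :* R) refl c d P R ⟩
      (c + d) * P + c * R
        ≡⟨ balanced ⟩
      c * P + (c + d) * R
        ≡⟨ solve 4 (λ c d P R → c :* P :+ (c :+ d) :* R :=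
                                 d :* R :+ (c :* P :+ c :* R)) refl c d P R ⟩
      d * R + (c * P + c * R) ∎))

  -- a₁² + a₂a₃ = a₁a₂ + a₁a₃ says (a₁ - a₂)(a₁ - a₃) = 0, so a₁ = a₃ when a₁ ≠ a₂.
  product-root : ∀ {a₁ a₂ a₃} → a₁ * a₁ + a₂ * a₃ ≡ a₁ * a₂ + a₁ * a₃ →
                 ¬ (a₁ ≡ a₂) → a₁ ≡ a₃
  product-root {a₁} {a₂} {a₃} factored a₁≢a₂ with offset a₁ a₂
  ... | d , refl = *-cancelˡ-nonzero (nonzero-offset a₁≢a₂)
    (+-cancelʳ (a₂ * a₂ + a₂ * d + a₂ * a₃) _ _ (begin
      d * (a₂ + d) + (a₂ * a₂ + a₂ * d + a₂ * a₃)
        ≡⟨ solve 3 (λ a₂ a₃ d →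
             d :* (a₂ :+ d) :+ (a₂ :* a₂ :+ a₂ :* d :+ a₂ :* a₃) :=
             (a₂ :+ d) :* (a₂ :+ d) :+ a₂ :* a₃) refl a₂ a₃ d ⟩
      (a₂ + d) * (a₂ + d) + a₂ * a₃
        ≡⟨ factored ⟩
      (a₂ + d) * a₂ + (a₂ + d) * a₃
        ≡⟨ solve 3 (λ a₂ a₃ d →
             (a₂ :+ d) :* a₂ :+ (a₂ :+ d) :* a₃ :=
             d :* a₃ :+ (a₂ :* a₂ :+ a₂ :* d :+ a₂ :* a₃)) refl a₂ a₃ d ⟩
      d * a₃ + (a₂ * a₂ + a₂ * d + a₂ * a₃) ∎))

module Triangles {q : ℕ} (F : FiniteField q) (r l : ℕ)
                 (α : Fin r → FiniteField.Carrier F)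
                 (m : Fin l → FiniteField.Carrier F) where
  open FiniteField F
  open Hypergraph F r l α m
  open FieldLemmas F
  open CycleRelations commutativeRing using (cycle-balance; eliminate-third-direction)

  part : Vertex → Fin r
  part (_ , _ , i) = i

  multiplier : EdgeParam → Fin l
  multiplier (_ , _ , _ , s) = s

  MeetAt : Fin r → EdgeParam → EdgeParam → Set
  MeetAt i e e' = vertexOf e i ≡ vertexOf e' i

  ∈E⇒vertexOf-part : ∀ {v} e → v ∈E e → v ≡ vertexOf e (part v)
  ∈E⇒vertexOf-part (_ , _ , _ , _) (_ , refl) = refl

  shared-vertex-meet : ∀ {v} e e' → v ∈E e → v ∈E e' → MeetAt (part v) e e'
  shared-vertex-meet e e' v∈e v∈e' =
    trans (sym (∈E⇒vertexOf-part e v∈e)) (∈E⇒vertexOf-part e' v∈e')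

  distinct-parts : ∀ {v w} e → v ∈E e → w ∈E e → ¬ (v ≡ w) → ¬ (part v ≡ part w)
  distinct-parts e v∈e w∈e v≢w same-part =
    v≢w (trans (∈E⇒vertexOf-part e v∈e)
          (trans (cong (vertexOf e) same-part) (sym (∈E⇒vertexOf-part e w∈e))))

  aOf : EdgeParam → Carrier
  aOf (_ , _ , (a , _) , _) = a

  -- Two edges with the same multiplier and the same a that share a vertex
  -- coincide: the common vertex then determines x and y.
  same-a-edges-coincide : ∀ {i} e e' → multiplier e ≡ multiplier e' →
    MeetAt i e e' → aOf e ≡ aOf e' → SameEdge e e'
  same-a-edges-coincide (_ , _ , _ , _) (_ , _ , _ , _) refl meet refl
    with +-cancelʳ _ _ _ (cong proj₁ meet) | +-cancelʳ _ _ _ (cong (proj₁ ∘ proj₂) meet)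
  ... | refl | refl = λ _ → mk⇔ id id

  single-multiplier-triangle-free :
    (∀ i j → α i ≡ α j → i ≡ j) → ∀ {s} → ¬ (m s ≡ 0#) →
    ∀ e₁ e₂ e₃ {i j k} →
    multiplier e₁ ≡ s → multiplier e₂ ≡ s → multiplier e₃ ≡ s →
    MeetAt j e₁ e₂ → MeetAt k e₂ e₃ → MeetAt i e₃ e₁ → ¬ (i ≡ j) →
    ¬ SameEdge e₁ e₂ → ¬ SameEdge e₁ e₃ → ⊥
  single-multiplier-triangle-free α-injective {s} mₛ≢0
    e₁@(x₁ , y₁ , (a₁ , _) , _) e₂@(x₂ , y₂ , (a₂ , _) , _) e₃@(x₃ , y₃ , (a₃ , _) , _)
    {i} {j} {k} refl refl refl meet₁₂ meet₂₃ meet₃₁ i≢j e₁≠e₂ e₁≠e₃ =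
    a₁≢a₃ (product-root (cross-cancel vanishing Bj≢Bi) a₁≢a₂)
    where
    B : Fin r → Carrier
    B t = α t * m s

    first second : Vertex → Carrier
    first = proj₁
    second = proj₁ ∘ proj₂

    vanishing : B j * (a₁ * a₁ + a₂ * a₃) + B i * (a₁ * a₂ + a₁ * a₃) ≡
                B i * (a₁ * a₁ + a₂ * a₃) + B j * (a₁ * a₂ + a₁ * a₃)
    vanishing = eliminate-third-direction (B i) (B j) (B k) a₁ a₂ a₃
      (cycle-balance (B i) (B j) (B k) a₁ a₂ a₃ x₁ x₂ x₃
        (cong first meet₁₂) (cong first meet₂₃) (cong first meet₃₁))
      (cycle-balance (B i) (B j) (B k) (a₁ * a₁) (a₂ * a₂) (a₃ * a₃) y₁ y₂ y₃
        (cong second meet₁₂) (cong second meet₂₃) (cong second meet₃₁))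

    Bj≢Bi : ¬ (B j ≡ B i)
    Bj≢Bi Bj≡Bi = i≢j (sym (α-injective j i (*-cancelʳ-nonzero mₛ≢0 Bj≡Bi)))

    a₁≢a₂ : ¬ (a₁ ≡ a₂)
    a₁≢a₂ a₁≡a₂ = e₁≠e₂ (same-a-edges-coincide e₁ e₂ refl meet₁₂ a₁≡a₂)

    a₁≢a₃ : ¬ (a₁ ≡ a₃)
    a₁≢a₃ a₁≡a₃ = e₁≠e₃ (same-a-edges-coincide e₁ e₃ refl (sym meet₃₁) a₁≡a₃)

-- With l = 1 every edge has the multiplier m_1, so a Berge triangle would be
-- a single-multiplier triangle; its vertices v₁ ≠ v₂ lie in distinct parts.
lemma3p6 : (q : ℕ) → OddPrimePower q → (F : FiniteField q) →
           (r l : ℕ) → 2 ≤ r → 1 ≤ l →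
           (α : Fin r → FiniteField.Carrier F) →
           (∀ i j → α i ≡ α j → i ≡ j) →
           (m : Fin l → FiniteField.Carrier F) →
           (∀ s → ¬ (m s ≡ FiniteField.0# F)) →
           (∀ s t → m s ≡ m t → s ≡ t) →
           (∀ s t i j k → ¬ (i ≡ j) → ¬ (j ≡ k) → ¬ (i ≡ k) →
             ¬ (FiniteField._*_ F (m s) (FiniteField._-_ F (α k) (α i))
                ≡ FiniteField._*_ F (m t) (FiniteField._-_ F (α k) (α j)))) →
           l ≡ 1 →
           Hypergraph.C3-free F r l α m
lemma3p6 q _ F r .1 _ _ α α-injective m m≢0 _ _ refl
  (e₁ , e₂ , e₃ , v₁ , v₂ , v₃ , e₁≠e₂ , _ , e₁≠e₃ , v₁≢v₂ , _ , _ ,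
   (v₁∈e₁ , v₂∈e₁) , (v₂∈e₂ , v₃∈e₂) , (v₃∈e₃ , v₁∈e₃)) =
  single-multiplier-triangle-free α-injective (m≢0 zero) e₁ e₂ e₃
    (only-multiplier e₁) (only-multiplier e₂) (only-multiplier e₃)
    (shared-vertex-meet e₁ e₂ v₂∈e₁ v₂∈e₂)
    (shared-vertex-meet e₂ e₃ v₃∈e₂ v₃∈e₃)
    (shared-vertex-meet e₃ e₁ v₁∈e₃ v₁∈e₁)
    (distinct-parts e₁ v₁∈e₁ v₂∈e₁ v₁≢v₂)
    e₁≠e₂ e₁≠e₃
  where
  open Hypergraph F r 1 α m using (EdgeParam)
  open Triangles F r 1 α m

  only-multiplier : ∀ (e : EdgeParam) → multiplier e ≡ zero
  only-multiplier (_ , _ , _ , zero) = refl
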